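{- Let $M$ be a partial epistemic model that is proper and has no empty world. Then $\sigma(M)$ is a generalized simplicial model. Moreover, if $M$ is minimal then $\sigma(M)$ is minimal, and if $M$ is maximal then $\sigma(M)$ is maximal.
   Context: Fix a finite set $A$ of agents and a set $\mathsf{AP}$ of atomic propositions. A chromatic simplicial complex is $\langle V,S,\chi\rangle$ with $S$ a family of non-empty subsets of $V$ containing all singletons and closed under non-empty subsets, and $\chi:V\to A$ injective on each $X\in S$. A generalized simplicial model is $\langle V,S,\chi,W,\ell\rangle$ with $\langle V,S,\chi\rangle$ a chromatic simplicial complex, $\mathrm{Facets}\subseteq W\subseteq S$ (facets = maximal simplices), $\ell:W\to\mathcal P(\mathsf{AP})$; minimal if $W$ is exactly the set of facets, maximal if $W=S$. A partial epistemic model is $M=\langle W,\sim,L\rangle$ where each $\sim_a$ ($a\in A$) is a symmetric transitive relation on $W$ and $L:W\to\mathcal P(\mathsf{AP})$; $\mathrm{live}(w)=\{a:w\sim_a w\}$. No empty world: $\mathrm{live}(w)\ne\emptyset$ for all $w$. Proper: for $w\neq w'$ with $\mathrm{live}(w)=\mathrm{live}(w')$ there is $a\in\mathrm{live}(w)$ with $w\not\sim_a w'$. Minimal: whenever $\mathrm{live}(w)\subsetneq\mathrm{live}(w')$ there is $a\in\mathrm{live}(w)$ with $w\not\sim_a w'$. Maximal: for every $w'$ and non-empty $B\subsetneq\mathrm{live}(w')$ there is $w$ with $\mathrm{live}(w)=B$ and $w\sim_a w'$ for all $a\in B$. For $a\in\mathrm{live}(w)$ let $[w]_a$ be the equivalence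 class of $w$ under $\sim_a$ restricted to $\{u: u\sim_a u\}$. $\sigma(M)=\langle V,S,\chi,\widehat W,\ell\rangle$ where $V=\{v^w_a:=(a,[w]_a): w\in W, a\in\mathrm{live}(w)\}$; $S$ consists of the sets $X_w=\{v^w_a: a\in\mathrm{live}(w)\}$ for $w\in W$ and all their non-empty subsets; $\chi(v^w_a)=a$; $\widehat W=\{X_w:w\in W\}$; $\ell(X_w)=L(w)$. -}

module Defs where

open import Level using (0ℓ)
open import Data.Nat using (ℕ)
open import Data.Fin using (Fin)
open import Data.Product using (Σ; ∃; _×_; _,_; proj₁; proj₂; Σ-syntax)
open import Relation.Nullary using (¬_)
open import Relation.Unary using (Pred; _⊆_; _≐_; _⊂_; Satisfiable)
open import Relation.Binary using (Setoid; Rel; IsEquivalence; _Respects_)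
open import Relation.Binary.PropositionalEquality using (_≡_; _≢_; refl)

-- Since there are no quotients, the vertex set V of a simplicial
-- complex is a setoid; its subsets are predicates on the carrier,
-- and equality of subsets is extensional equality  _≐_ .

module _ (V : Setoid 0ℓ 0ℓ) where
  open Setoid V renaming (Carrier to Vc)

  IsSubset : Pred Vc 0ℓ → Set
  IsSubset X = X Respects _≈_

  record IsChromaticComplex {n : ℕ} (S : Pred (Pred Vc 0ℓ) 0ℓ) (χ : Vc → Fin n) : Set₁ where
    field
      χ-resp      : ∀ {u v} → u ≈ v → χ u ≡ χ v
      S-subset    : ∀ X → S X → IsSubset X
      S-nonempty  : ∀ X → S X → Satisfiable X
      S-singleton : ∀ v → S (λ u → u ≈ v)
      S-down      : ∀ X Y → S X → IsSubset Y → Satisfiable Y → Y ⊆ X → S Y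
      χ-injective : ∀ X → S X → ∀ u v → X u → X v → χ u ≡ χ v → u ≈ v

  Facet : Pred (Pred Vc 0ℓ) 0ℓ → Pred Vc 0ℓ → Set₁
  Facet S X = S X × (∀ Y → S Y → X ⊆ Y → Y ⊆ X)

  -- generalized simplicial model ⟨V,S,χ,W,ℓ⟩ with labelling ℓ : W → 𝒫(AP).
  -- ℓ is given on members of W; ℓ-wd says it is a function of the set X.
  record IsGSM {n : ℕ} {AP : Set} (S : Pred (Pred Vc 0ℓ) 0ℓ) (χ : Vc → Fin n)
               (W : Pred (Pred Vc 0ℓ) 0ℓ)
               (ℓ : (X : Pred Vc 0ℓ) → W X → Pred AP 0ℓ) : Set₁ where
    field
      complex   : IsChromaticComplex S χ
      W-resp    : ∀ X Y → X ≐ Y → W X → W Y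
      facets⊆W  : ∀ X → Facet S X → W X
      W⊆S       : ∀ X → W X → S X
      ℓ-wd      : ∀ X Y (p : W X) (q : W Y) → X ≐ Y → ℓ X p ≐ ℓ Y q

  -- minimal: W is exactly the set of facets (facets ⊆ W is part of IsGSM)
  IsMinimalGSM : (S W : Pred (Pred Vc 0ℓ) 0ℓ) → Set₁
  IsMinimalGSM S W = ∀ X → W X → Facet S X

  -- maximal: W = S (W ⊆ S is part of IsGSM)
  IsMaximalGSM : (S W : Pred (Pred Vc 0ℓ) 0ℓ) → Set₁
  IsMaximalGSM S W = ∀ X → S X → W X

record PEM (n : ℕ) (AP : Set) : Set₁ where
  field
    World : Set
    R     : Fin n → Rel World 0ℓ          -- w ∼_a w'  is  R a w w'
    R-sym : ∀ a {w w'} → R a w w' → R a w' w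
    R-trans : ∀ a {w w' w''} → R a w w' → R a w' w'' → R a w w''
    L     : World → Pred AP 0ℓ

  live : World → Pred (Fin n) 0ℓ
  live w a = R a w w

module _ {n : ℕ} {AP : Set} (M : PEM n AP) where
  open PEM M

  NoEmptyWorld : Set
  NoEmptyWorld = ∀ w → Satisfiable (live w)

  Proper : Set
  Proper = ∀ w w' → w ≢ w' → live w ≐ live w' →
           Σ[ a ∈ Fin n ] (live w a × ¬ R a w w')

  MinimalPEM : Set
  MinimalPEM = ∀ w w' → live w ⊂ live w' →
               Σ[ a ∈ Fin n ] (live w a × ¬ R a w w')

  MaximalPEM : Set₁
  MaximalPEM = ∀ w' (B : Pred (Fin n) 0ℓ) → Satisfiable B → B ⊂ live w' →
               Σ[ w ∈ World ] (live w ≐ B × (∀ a → B a → R a w w'))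

  -- A vertex v^w_a = (a,[w]_a) is represented by a triple
  -- (a , w , a ∈ live w);  two representatives are equal as vertices
  -- iff they have the same agent a and the worlds are a-related
  -- (i.e. have the same ∼_a-class).

  σVc : Set
  σVc = Σ[ a ∈ Fin n ] Σ[ w ∈ World ] live w a

  _≈σ_ : Rel σVc 0ℓ
  (a , w , _) ≈σ (b , w' , _) = Σ (a ≡ b) (λ _ → R a w w')

  private
    ≈σ-refl : ∀ {x} → x ≈σ x
    ≈σ-refl {a , w , lw} = refl , lw

    ≈σ-sym : ∀ {x y} → x ≈σ y → y ≈σ x
    ≈σ-sym {a , _ , _} {_ , _ , _} (refl , r) = refl , R-sym a r

    ≈σ-trans : ∀ {x y z} → x ≈σ y → y ≈σ z → x ≈σ z
    ≈σ-trans {a , _ , _} {_ , _ , _} {_ , _ , _} (refl , r) (refl , r') = refl , R-trans a r r'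

  σV : Setoid 0ℓ 0ℓ
  σV = record
    { Carrier = σVc
    ; _≈_ = _≈σ_
    ; isEquivalence = record { refl = λ {x} → ≈σ-refl {x} ; sym = λ {x} {y} → ≈σ-sym {x} {y} ; trans = λ {x} {y} {z} → ≈σ-trans {x} {y} {z} }
    }

  vtx : (w : World) (a : Fin n) → live w a → σVc
  vtx w a lw = (a , w , lw)

  Xw : World → Pred σVc 0ℓ
  Xw w v = Σ[ a ∈ Fin n ] Σ[ lw ∈ live w a ] (v ≈σ vtx w a lw)

  σχ : σVc → Fin n
  σχ (a , _ , _) = a

  σS : Pred (Pred σVc 0ℓ) 0ℓ
  σS Y = IsSubset σV Y × Satisfiable Y × Σ[ w ∈ World ] (Y ⊆ Xw w)

  σW : Pred (Pred σVc 0ℓ) 0ℓ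
  σW Y = Σ[ w ∈ World ] (Y ≐ Xw w)

  σℓ : (X : Pred σVc 0ℓ) → σW X → Pred AP 0ℓ
  σℓ X (w , _) = L w

{-# OPTIONS --safe #-}
-- A vertex (a , u) lies on the simplex X_w exactly when u ∼_a w, so X_w ⊆ X_w'
-- says precisely that w ∼_a w' for every agent a live at w.  Everything about
-- σ(M) is read off this: properness makes w ↦ X_w injective (so ℓ is well
-- defined), minimality of M rules out proper inclusions X_w ⊂ X_w', and
-- maximality of M realises every face of X_w' as some X_w, namely the one whose
-- live agents are the colours of the face (or X_w' itself if the face uses all
-- its colours).  Excluded middle decides w = w', liveness, and that last case.
module Submission where

open import Defs
open import Level using (0ℓ)
open import Data.Nat using (ℕ)
open import Data.Fin using (Fin)
open import Data.Product using (_×_; _,_; proj₁; ∃)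
open import Relation.Nullary using (yes; no)
open import Relation.Nullary.Decidable using (decidable-stable)
open import Relation.Unary using (Pred; _⊆_; _≐_)
open import Relation.Unary.Properties using (≐-refl; ≐-sym; ≐-trans)
open import Relation.Binary.PropositionalEquality using (_≡_; refl)
open import Axiom.ExcludedMiddle using (ExcludedMiddle)

module _ {n : ℕ} {AP : Set} (M : PEM n AP) where
  open PEM M

  -- Vertices are passed explicitly (also via λ {v} → h {v} for inclusions h):
  -- _≈σ_ matches on triples, so types mentioning a vertex reduce to its
  -- projections, where the liveness proof in the third component never occurs.

  Simplex : Set₁
  Simplex = Pred (σVc M) 0ℓ

  worldOf : σVc M → World
  worldOf (_ , u , _) = u

  colours : Simplex → Pred (Fin n) 0ℓ
  colours Y a = ∃ λ v → Y v × σχ M v ≡ a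

  R⇒liveʳ : ∀ {a u w} → R a u w → live w a
  R⇒liveʳ {a} r = R-trans a (R-sym a r) r

  ∈Xw⇒R : ∀ {w} v → Xw M w v → R (σχ M v) (worldOf v) w
  ∈Xw⇒R (_ , _ , _) (_ , _ , refl , r) = r

  R⇒∈Xw : ∀ {w} v → R (σχ M v) (worldOf v) w → Xw M w v
  R⇒∈Xw (_ , _ , _) r = _ , R⇒liveʳ r , refl , r

  Xw⊆Xw⇒R : ∀ {w w'} → Xw M w ⊆ Xw M w' → ∀ {a} → live w a → R a w w'
  Xw⊆Xw⇒R {w} Xw⊆Xw' {a} lw = ∈Xw⇒R v (Xw⊆Xw' {v} (R⇒∈Xw v lw))
    where v = (a , w , lw)

  R⇒Xw⊆Xw : ∀ {w w'} → (∀ {a} → live w a → R a w w') → Xw M w ⊆ Xw M w'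
  R⇒Xw⊆Xw related {v@(a , _ , _)} v∈Xw =
    R⇒∈Xw v (R-trans a (∈Xw⇒R v v∈Xw) (related (R⇒liveʳ (∈Xw⇒R v v∈Xw))))

  Xw⊆Xw⇒live⊆live : ∀ {w w'} → Xw M w ⊆ Xw M w' → live w ⊆ live w'
  Xw⊆Xw⇒live⊆live Xw⊆Xw' lw = R⇒liveʳ (Xw⊆Xw⇒R (λ {v} → Xw⊆Xw' {v}) lw)

  Xw-isSubset : ∀ w → IsSubset (σV M) (Xw M w)
  Xw-isSubset w {u@(a , _ , _)} {v@(.a , _ , _)} (refl , r) u∈Xw =
    R⇒∈Xw v (R-trans a (R-sym a r) (∈Xw⇒R u u∈Xw))

  σS-resp-≐ : ∀ {X Y : Simplex} → X ≐ Y → σS M Y → σS M X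
  σS-resp-≐ (X⊆Y , Y⊆X) (respY , (v , v∈Y) , w , Y⊆Xw) =
    (λ {x} {y} x≈y x∈X → Y⊆X (respY {x} {y} x≈y (X⊆Y x∈X)))
    , (v , Y⊆X v∈Y) , w , λ x∈X → Y⊆Xw (X⊆Y x∈X)

  σ-isChromaticComplex : IsChromaticComplex (σV M) (σS M) (σχ M)
  σ-isChromaticComplex = record
    { χ-resp      = λ { {_ , _ , _} {_ , _ , _} (a≡b , _) → a≡b }
    ; S-subset    = λ _ → proj₁
    ; S-nonempty  = λ _ (_ , sat , _) → sat
    ; S-singleton = singleton
    ; S-down      = λ X Y (_ , _ , w , X⊆Xw) respY satY Y⊆X →
                      respY , satY , w , λ y∈Y → X⊆Xw (Y⊆X y∈Y)
    ; χ-injective = χ-injective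
    }
    where
    singleton : ∀ v → σS M (λ u → _≈σ_ M u v)
    singleton v@(a , w , lw) =
      (λ { {b , _ , _} {.b , _ , _} (refl , r) (refl , r') → refl , R-trans b (R-sym b r) r' })
      , (v , refl , lw) , w , λ { {u@(_ , _ , _)} (refl , r) → R⇒∈Xw u r }

    χ-injective : ∀ X → σS M X → ∀ u v → X u → X v → σχ M u ≡ σχ M v → _≈σ_ M u v
    χ-injective X (_ , _ , w , X⊆Xw) u@(a , _ , _) v@(.a , _ , _) u∈X v∈X refl =
      refl , R-trans a (∈Xw⇒R u (X⊆Xw u∈X)) (R-sym a (∈Xw⇒R v (X⊆Xw v∈X)))

  Xw∈σS : NoEmptyWorld M → ∀ w → σS M (Xw M w)
  Xw∈σS noEmpty w with noEmpty w
  ... | a , lw = (λ {x} {y} → Xw-isSubset w {x} {y}) , (v , R⇒∈Xw v lw) , w , (λ v∈Xw → v∈Xw)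
    where v = (a , w , lw)

  σW⇒σS : NoEmptyWorld M → ∀ X → σW M X → σS M X
  σW⇒σS noEmpty X (w , X≐Xw) = σS-resp-≐ X≐Xw (Xw∈σS noEmpty w)

  facet⇒σW : NoEmptyWorld M → ∀ X → Facet (σV M) (σS M) X → σW M X
  facet⇒σW noEmpty X ((_ , _ , w , X⊆Xw) , maximal) =
    w , X⊆Xw , maximal (Xw M w) (Xw∈σS noEmpty w) X⊆Xw

  Xw-injective : ExcludedMiddle 0ℓ → Proper M → ∀ {w w'} → Xw M w ≐ Xw M w' → w ≡ w'
  Xw-injective lem proper {w} {w'} (Xw⊆Xw' , Xw'⊆Xw) = decidable-stable lem λ w≢w' →
    let (a , lw , ¬R) = proper w w' w≢w' live≐live'
    in ¬R (Xw⊆Xw⇒R (λ {v} → Xw⊆Xw' {v}) lw)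
    where
    live≐live' : live w ≐ live w'
    live≐live' = Xw⊆Xw⇒live⊆live (λ {v} → Xw⊆Xw' {v}) , Xw⊆Xw⇒live⊆live (λ {v} → Xw'⊆Xw {v})

  σ-isGSM : ExcludedMiddle 0ℓ → Proper M → NoEmptyWorld M →
            IsGSM (σV M) (σS M) (σχ M) (σW M) (σℓ M)
  σ-isGSM lem proper noEmpty = record
    { complex  = σ-isChromaticComplex
    ; W-resp   = λ X Y X≐Y (w , X≐Xw) → w , ≐-trans (≐-sym X≐Y) X≐Xw
    ; facets⊆W = facet⇒σW noEmpty
    ; W⊆S      = σW⇒σS noEmpty
    ; ℓ-wd     = ℓ-wd
    }
    where
    ℓ-wd : ∀ X Y (p : σW M X) (q : σW M Y) → X ≐ Y → σℓ M X p ≐ σℓ M Y q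
    ℓ-wd X Y (w , X≐Xw) (w' , Y≐Xw') X≐Y
      with Xw-injective lem proper (≐-trans (≐-sym X≐Xw) (≐-trans X≐Y Y≐Xw'))
    ... | refl = ≐-refl

  Xw⊆Xw⇒Xw⊇Xw : ExcludedMiddle 0ℓ → MinimalPEM M →
                ∀ {w w'} → Xw M w ⊆ Xw M w' → Xw M w' ⊆ Xw M w
  Xw⊆Xw⇒Xw⊇Xw lem minimal {w} {w'} Xw⊆Xw' {v} =
    R⇒Xw⊆Xw (λ {a} lw' → R-sym a (related (live'⊆live lw'))) {v}
    where
    related : ∀ {a} → live w a → R a w w'
    related = Xw⊆Xw⇒R (λ {v} → Xw⊆Xw' {v})

    live⊆live' : live w ⊆ live w'
    live⊆live' = Xw⊆Xw⇒live⊆live (λ {v} → Xw⊆Xw' {v})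

    live'⊆live : live w' ⊆ live w
    live'⊆live lw' = decidable-stable lem λ ¬lw →
      let (b , lb , ¬R) = minimal w w' (live⊆live' , λ live'⊆live → ¬lw (live'⊆live lw'))
      in ¬R (related lb)

  σ-isMinimalGSM : ExcludedMiddle 0ℓ → NoEmptyWorld M → MinimalPEM M →
                   IsMinimalGSM (σV M) (σS M) (σW M)
  σ-isMinimalGSM lem noEmpty minimal X X∈σW@(w , _ , Xw⊆X) =
    σW⇒σS noEmpty X X∈σW , X-maximal
    where
    X-maximal : ∀ Y → σS M Y → X ⊆ Y → Y ⊆ X
    X-maximal Y (_ , _ , w' , Y⊆Xw') X⊆Y {v} v∈Y = Xw⊆X {v} (Xw'⊆Xw {v} (Y⊆Xw' v∈Y))
      where
      Xw'⊆Xw : Xw M w' ⊆ Xw M w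
      Xw'⊆Xw {u} = Xw⊆Xw⇒Xw⊇Xw lem minimal (λ {u'} u'∈Xw → Y⊆Xw' (X⊆Y (Xw⊆X {u'} u'∈Xw))) {u}

  colours⊆live : ∀ {Y w} → Y ⊆ Xw M w → colours Y ⊆ live w
  colours⊆live Y⊆Xw (v , v∈Y , refl) = R⇒liveʳ (∈Xw⇒R v (Y⊆Xw v∈Y))

  face≐Xw : ∀ {Y w' w} → IsSubset (σV M) Y → Y ⊆ Xw M w' →
            live w ⊆ colours Y → (∀ {a} → colours Y a → R a w w') → Y ≐ Xw M w
  face≐Xw {Y} {w = w} respY Y⊆Xw' live⊆colours related = Y⊆Xw , Xw⊆Y
    where
    Y⊆Xw : Y ⊆ Xw M w
    Y⊆Xw {u@(a , _ , _)} u∈Y =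
      R⇒∈Xw u (R-trans a (∈Xw⇒R u (Y⊆Xw' u∈Y)) (R-sym a (related (u , u∈Y , refl))))

    Xw⊆Y : Xw M w ⊆ Y
    Xw⊆Y {u@(a , _ , _)} u∈Xw with live⊆colours (R⇒liveʳ (∈Xw⇒R u u∈Xw))
    ... | v@(.a , _ , _) , v∈Y , refl = respY {v} {u} (refl , v∼u) v∈Y
      where
      v∼u : R a (worldOf v) (worldOf u)
      v∼u = R-trans a (∈Xw⇒R v (Y⊆Xw' v∈Y))
              (R-trans a (R-sym a (related (v , v∈Y , refl))) (R-sym a (∈Xw⇒R u u∈Xw)))

  σ-isMaximalGSM : ExcludedMiddle 0ℓ → MaximalPEM M → IsMaximalGSM (σV M) (σS M) (σW M)
  σ-isMaximalGSM lem maximal Y (respY , (v , v∈Y) , w' , Y⊆Xw') with lem {live w' ⊆ colours Y}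
  ... | yes live⊆colours = w' , face≐Xw respY Y⊆Xw' live⊆colours (colours⊆live Y⊆Xw')
  ... | no live⊈colours
    with maximal w' (colours Y) (σχ M v , v , v∈Y , refl) (colours⊆live Y⊆Xw' , live⊈colours)
  ... | w , (live⊆colours , _) , related = w , face≐Xw respY Y⊆Xw' live⊆colours (λ {a} → related a)

proposition30 : ExcludedMiddle 0ℓ →
    ∀ {n : ℕ} {AP : Set} (M : PEM n AP) → Proper M → NoEmptyWorld M →
      IsGSM (σV M) (σS M) (σχ M) (σW M) (σℓ M)
      × (MinimalPEM M → IsMinimalGSM (σV M) (σS M) (σW M))
      × (MaximalPEM M → IsMaximalGSM (σV M) (σS M) (σW M))
proposition30 lem M proper noEmpty =
  σ-isGSM M lem proper noEmpty , σ-isMinimalGSM M lem noEmpty , σ-isMaximalGSM M lem
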